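{- Let $\mathsf{K}$ be a left distributive $\omega\mathsf{Cpo}^\vee$-enriched category and $J$ a subcategory containing all objects of $\mathsf{K}$. Then the functor $[!,\mathsf{K}]^J:[1,\mathsf{K}]^J\to[\mathbb{N},\mathsf{K}]^J$ admits a left 2-adjoint $\Sigma_!$.
   Context: $\omega\mathsf{Cpo}^\vee$-enriched: every hom-set is a poset with binary joins and suprema of ascending $\omega$-chains, and composition is monotone and preserves suprema of ascending $\omega$-chains in each variable. Left distributive: $h\circ(f\vee g)=h\circ f\vee h\circ g$. $[\mathbb{N},\mathsf{K}]^J$: objects are families $(\pi_n)_{n\in\mathbb{N}}$ of endomorphisms of a common object $X$ with $id_X\leq\pi_0$ and $\pi_m\circ\pi_n\leq\pi_{m+n}$ (lax functors from the monoid $(\mathbb{N},+,0)$); morphisms $\pi\to\pi'$ are arrows $f$ of $J$ with $f\circ\pi_n\leq\pi'_n\circ f$ for all $n$; order from $\mathsf{K}$. $[1,\mathsf{K}]^J$: objects are endomorphisms $\rho$ with $id\leq\rho$ and $\rho\circ\rho\leq\rho$; morphisms are $J$-arrows $f$ with $f\circ\rho\leq\rho'\circ f$. $[!,\mathsf{K}]^J$ sends $\rho$ to the constant sequence $(\rho)_{n\in\mathbb{N}}$ and $f$ to $f$. A left 2-adjoint is a hom-order preserving functor $F$ with poset isomorphisms $\mathsf{B}(FX,Y)\cong\mathsf{A}(X,UY)$ natural in $X,Y$, where $U$ is also hom-order preserving. -}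

module Defs where

open import Level using (Level; _⊔_; suc)
open import Data.Nat using (ℕ; zero; _+_) renaming (suc to sucℕ)
open import Data.Product using (_×_)
open import Relation.Binary.PropositionalEquality using (_≡_)

record ωCpoJoinCat (o h ℓ : Level) : Set (suc (o ⊔ h ⊔ ℓ)) where
  infixr 9 _∘_
  infix 4 _≤_
  infixr 6 _∨_
  field
    Obj  : Set o
    Hom  : Obj → Obj → Set h
    id   : ∀ {A} → Hom A A
    _∘_  : ∀ {A B C} → Hom B C → Hom A B → Hom A C
    assoc     : ∀ {A B C D} (f : Hom A B) (g : Hom B C) (k : Hom C D) →
                (k ∘ g) ∘ f ≡ k ∘ (g ∘ f)
    identityˡ : ∀ {A B} (f : Hom A B) → id ∘ f ≡ f
    identityʳ : ∀ {A B} (f : Hom A B) → f ∘ id ≡ f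
    _≤_      : ∀ {A B} → Hom A B → Hom A B → Set ℓ
    ≤-refl   : ∀ {A B} {f : Hom A B} → f ≤ f
    ≤-trans  : ∀ {A B} {f g k : Hom A B} → f ≤ g → g ≤ k → f ≤ k
    ≤-antisym : ∀ {A B} {f g : Hom A B} → f ≤ g → g ≤ f → f ≡ g
    _∨_   : ∀ {A B} → Hom A B → Hom A B → Hom A B
    ∨-inl : ∀ {A B} (f g : Hom A B) → f ≤ f ∨ g
    ∨-inr : ∀ {A B} (f g : Hom A B) → g ≤ f ∨ g
    ∨-least : ∀ {A B} {f g k : Hom A B} → f ≤ k → g ≤ k → f ∨ g ≤ k
    sup       : ∀ {A B} (c : ℕ → Hom A B) → (∀ n → c n ≤ c (sucℕ n)) → Hom A B
    sup-upper : ∀ {A B} (c : ℕ → Hom A B) (asc : ∀ n → c n ≤ c (sucℕ n)) →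
                ∀ n → c n ≤ sup c asc
    sup-least : ∀ {A B} (c : ℕ → Hom A B) (asc : ∀ n → c n ≤ c (sucℕ n)) →
                {k : Hom A B} → (∀ n → c n ≤ k) → sup c asc ≤ k
    ∘-mono : ∀ {A B C} {f f' : Hom A B} {g g' : Hom B C} →
             f ≤ f' → g ≤ g' → g ∘ f ≤ g' ∘ f'
    ∘-supʳ : ∀ {A B C} (g : Hom B C) (c : ℕ → Hom A B)
             (asc : ∀ n → c n ≤ c (sucℕ n)) →
             g ∘ sup c asc ≡ sup (λ n → g ∘ c n) (λ n → ∘-mono (asc n) ≤-refl)
    ∘-supˡ : ∀ {A B C} (c : ℕ → Hom B C) (asc : ∀ n → c n ≤ c (sucℕ n))
             (f : Hom A B) →
             sup c asc ∘ f ≡ sup (λ n → c n ∘ f) (λ n → ∘-mono ≤-refl (asc n))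

LeftDistributive : ∀ {o h ℓ} → ωCpoJoinCat o h ℓ → Set (o ⊔ h)
LeftDistributive K = ∀ {A B C} (k : Hom B C) (f g : Hom A B) →
                     k ∘ (f ∨ g) ≡ (k ∘ f) ∨ (k ∘ g)
  where open ωCpoJoinCat K

record WideSubcategory {o h ℓ} (K : ωCpoJoinCat o h ℓ) (j : Level)
       : Set (o ⊔ h ⊔ suc j) where
  open ωCpoJoinCat K
  field
    InJ    : ∀ {A B} → Hom A B → Set j
    id-J   : ∀ {A} → InJ (id {A})
    ∘-J    : ∀ {A B C} {g : Hom B C} {f : Hom A B} → InJ g → InJ f → InJ (g ∘ f)

record OrdCat (o h e ℓ : Level) : Set (suc (o ⊔ h ⊔ e ⊔ ℓ)) where
  infixr 9 _∘_
  infix 4 _≤_ _≈_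
  field
    Obj : Set o
    Hom : Obj → Obj → Set h
    _≈_ : ∀ {A B} → Hom A B → Hom A B → Set e
    _≤_ : ∀ {A B} → Hom A B → Hom A B → Set ℓ
    id  : ∀ {A} → Hom A A
    _∘_ : ∀ {A B C} → Hom B C → Hom A B → Hom A C

record OrdFunctor {o h e ℓ o' h' e' ℓ'}
       (C : OrdCat o h e ℓ) (D : OrdCat o' h' e' ℓ')
       : Set (o ⊔ h ⊔ e ⊔ ℓ ⊔ o' ⊔ h' ⊔ e' ⊔ ℓ') where
  private
    module C = OrdCat C
    module D = OrdCat D
  field
    F₀ : C.Obj → D.Obj
    F₁ : ∀ {A B} → C.Hom A B → D.Hom (F₀ A) (F₀ B)
    F-resp-≈ : ∀ {A B} {f g : C.Hom A B} → f C.≈ g → F₁ f D.≈ F₁ g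
    F-id  : ∀ {A} → F₁ (C.id {A}) D.≈ D.id
    F-∘   : ∀ {A B E} (g : C.Hom B E) (f : C.Hom A B) →
            F₁ (g C.∘ f) D.≈ F₁ g D.∘ F₁ f
    F-mono : ∀ {A B} {f g : C.Hom A B} → f C.≤ g → F₁ f D.≤ F₁ g

-- F ⊣ U as a 2-adjunction: poset isomorphisms B(F X, Y) ≅ A(X, U Y)
-- natural in X and Y.
record Left2Adjoint {o h e ℓ o' h' e' ℓ'}
       {A : OrdCat o h e ℓ} {B : OrdCat o' h' e' ℓ'}
       (F : OrdFunctor A B) (U : OrdFunctor B A)
       : Set (o ⊔ h ⊔ e ⊔ ℓ ⊔ o' ⊔ h' ⊔ e' ⊔ ℓ') where
  private
    module A = OrdCat A
    module B = OrdCat B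
    module F = OrdFunctor F
    module U = OrdFunctor U
  field
    φ : ∀ {X Y} → B.Hom (F.F₀ X) Y → A.Hom X (U.F₀ Y)
    ψ : ∀ {X Y} → A.Hom X (U.F₀ Y) → B.Hom (F.F₀ X) Y
    φ-resp-≈ : ∀ {X Y} {f g : B.Hom (F.F₀ X) Y} → f B.≈ g → φ f A.≈ φ g
    ψ-resp-≈ : ∀ {X Y} {f g : A.Hom X (U.F₀ Y)} → f A.≈ g → ψ f B.≈ ψ g
    ψφ : ∀ {X Y} (f : B.Hom (F.F₀ X) Y) → ψ (φ f) B.≈ f
    φψ : ∀ {X Y} (g : A.Hom X (U.F₀ Y)) → φ (ψ g) A.≈ g
    φ-mono : ∀ {X Y} {f g : B.Hom (F.F₀ X) Y} → f B.≤ g → φ f A.≤ φ g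
    ψ-mono : ∀ {X Y} {f g : A.Hom X (U.F₀ Y)} → f A.≤ g → ψ f B.≤ ψ g
    natural : ∀ {X X' Y Y'} (k : A.Hom X' X) (f : B.Hom (F.F₀ X) Y)
              (g : B.Hom Y Y') →
              φ (g B.∘ (f B.∘ F.F₁ k)) A.≈ U.F₁ g A.∘ (φ f A.∘ k)

module _ {o h ℓ j} (K : ωCpoJoinCat o h ℓ) (J : WideSubcategory K j) where
  open ωCpoJoinCat K
  open WideSubcategory J

  -- lax functors (ℕ,+,0) → K
  record LaxSeq : Set (o ⊔ h ⊔ ℓ) where
    field
      carrier : Obj
      π       : ℕ → Hom carrier carrier
      unit    : id ≤ π 0
      mult    : ∀ m n → π m ∘ π n ≤ π (m + n)

  record LaxSeqHom (P Q : LaxSeq) : Set (h ⊔ ℓ ⊔ j) where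
    private
      module P = LaxSeq P
      module Q = LaxSeq Q
    field
      arr : Hom P.carrier Q.carrier
      inJ : InJ arr
      com : ∀ n → arr ∘ P.π n ≤ Q.π n ∘ arr

  open LaxSeqHom

  -- lax functors 1 → K (closure-like endomorphisms)
  record LaxMonad : Set (o ⊔ h ⊔ ℓ) where
    field
      carrier : Obj
      ρ       : Hom carrier carrier
      unit    : id ≤ ρ
      mult    : ρ ∘ ρ ≤ ρ

  record LaxMonadHom (P Q : LaxMonad) : Set (h ⊔ ℓ ⊔ j) where
    private
      module P = LaxMonad P
      module Q = LaxMonad Q
    field
      arr : Hom P.carrier Q.carrier
      inJ : InJ arr
      com : arr ∘ P.ρ ≤ Q.ρ ∘ arr

  open LaxMonadHom

  LaxSeqCat : OrdCat (o ⊔ h ⊔ ℓ) (h ⊔ ℓ ⊔ j) h ℓ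
  LaxSeqCat = record
    { Obj = LaxSeq
    ; Hom = LaxSeqHom
    ; _≈_ = λ f g → arr f ≡ arr g
    ; _≤_ = λ f g → arr f ≤ arr g
    ; id  = λ {P} → record
        { arr = id ; inJ = id-J
        ; com = λ n → ≤-trans (≤-reflexive′ (identityˡ _))
                              (≤-reflexive′ (sym′ (identityʳ _))) }
    ; _∘_ = λ {P} {Q} {R} g f → record
        { arr = arr g ∘ arr f ; inJ = ∘-J (inJ g) (inJ f)
        ; com = λ n → comp-com (arr g) (arr f) (LaxSeq.π P n)
                        (LaxSeq.π Q n) (LaxSeq.π R n) (com g n) (com f n) }
    }
    where
    open import Relation.Binary.PropositionalEquality using (subst; sym)
    ≤-reflexive′ : ∀ {A B} {f g : Hom A B} → f ≡ g → f ≤ g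
    ≤-reflexive′ {f = f} e = subst (λ x → f ≤ x) e ≤-refl
    sym′ : ∀ {A B} {f g : Hom A B} → f ≡ g → g ≡ f
    sym′ = sym
    comp-com : ∀ {A B C} (g : Hom B C) (f : Hom A B) (p : Hom A A)
               (q : Hom B B) (r : Hom C C) →
               g ∘ q ≤ r ∘ g → f ∘ p ≤ q ∘ f → (g ∘ f) ∘ p ≤ r ∘ (g ∘ f)
    comp-com g f p q r cg cf =
      ≤-trans (≤-reflexive′ (assoc p f g))
      (≤-trans (∘-mono cf ≤-refl)
      (≤-trans (≤-reflexive′ (sym′ (assoc f q g)))
      (≤-trans (∘-mono ≤-refl cg)
               (≤-reflexive′ (assoc f g r)))))

  LaxMonadCat : OrdCat (o ⊔ h ⊔ ℓ) (h ⊔ ℓ ⊔ j) h ℓ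
  LaxMonadCat = record
    { Obj = LaxMonad
    ; Hom = LaxMonadHom
    ; _≈_ = λ f g → arr f ≡ arr g
    ; _≤_ = λ f g → arr f ≤ arr g
    ; id  = λ {P} → record
        { arr = id ; inJ = id-J
        ; com = ≤-trans (≤-reflexive′ (identityˡ _))
                        (≤-reflexive′ (sym′ (identityʳ _))) }
    ; _∘_ = λ {P} {Q} {R} g f → record
        { arr = arr g ∘ arr f ; inJ = ∘-J (inJ g) (inJ f)
        ; com = comp-com (arr g) (arr f) (LaxMonad.ρ P)
                  (LaxMonad.ρ Q) (LaxMonad.ρ R) (com g) (com f) }
    }
    where
    open import Relation.Binary.PropositionalEquality using (subst; sym)
    ≤-reflexive′ : ∀ {A B} {f g : Hom A B} → f ≡ g → f ≤ g
    ≤-reflexive′ {f = f} e = subst (λ x → f ≤ x) e ≤-refl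
    sym′ : ∀ {A B} {f g : Hom A B} → f ≡ g → g ≡ f
    sym′ = sym
    comp-com : ∀ {A B C} (g : Hom B C) (f : Hom A B) (p : Hom A A)
               (q : Hom B B) (r : Hom C C) →
               g ∘ q ≤ r ∘ g → f ∘ p ≤ q ∘ f → (g ∘ f) ∘ p ≤ r ∘ (g ∘ f)
    comp-com g f p q r cg cf =
      ≤-trans (≤-reflexive′ (assoc p f g))
      (≤-trans (∘-mono cf ≤-refl)
      (≤-trans (≤-reflexive′ (sym′ (assoc f q g)))
      (≤-trans (∘-mono ≤-refl cg)
               (≤-reflexive′ (assoc f g r)))))

  constSeq : LaxMonad → LaxSeq
  constSeq P = record
    { carrier = LaxMonad.carrier P
    ; π       = λ _ → LaxMonad.ρ P
    ; unit    = LaxMonad.unit P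
    ; mult    = λ _ _ → LaxMonad.mult P
    }

  BangFunctor : OrdFunctor LaxMonadCat LaxSeqCat
  BangFunctor = record
    { F₀ = constSeq
    ; F₁ = λ f → record { arr = arr f ; inJ = inJ f ; com = λ _ → com f }
    ; F-resp-≈ = λ e → e
    ; F-id = refl
    ; F-∘ = λ _ _ → refl
    ; F-mono = λ p → p
    }
    where open import Relation.Binary.PropositionalEquality using (refl)

module Submission where

-- The left 2-adjoint Σ! of [!,K]^J sends a lax sequence (πₙ) on X to its
-- free closure: the least endomorphism ρ of X with id ≤ ρ, ρ ∘ ρ ≤ ρ and
-- πₙ ≤ ρ for all n, built from the ω-chain
--     cₖ = π₀ ∨ … ∨ πₖ,      dₖ = cₖ^(k+1),      ρ = sup dₖ.
-- Every cₖ is inflationary (it contains π₀ ≥ id), so the dₖ ascend, and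
-- dₖ ∘ dₘ ≤ d_(k+m+1) together with continuity of composition makes ρ a
-- closure.  The key fact is the universal property of ρ: if a J-arrow g
-- satisfies g ∘ πₙ ≤ y ∘ g for all n and a closure y, then g ∘ ρ ≤ y ∘ g
-- (left distributivity lets the lax commutation pass through the joins
-- cₖ).  It gives both the action of Σ! on morphisms and the inverse of
-- the restriction map; the hom-bijection is then the identity on
-- underlying arrows, so all 2-adjunction laws hold by reflexivity.

open import Defs
open import Data.Product using (Σ; _,_)
open import Data.Nat using (ℕ; zero; suc; _+_; z≤n; _≤′_; ≤′-refl; ≤′-step)
  renaming (_≤_ to _≤ℕ_)
open import Data.Nat.Properties using (≤⇒≤′; m≤m+n; m≤n+m; n≤1+n)
  renaming (≤-trans to ℕ≤-trans)
open import Relation.Binary.Bundles using (Poset)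
open import Relation.Binary.PropositionalEquality
  using (_≡_; refl; sym; cong; subst; isEquivalence; module ≡-Reasoning)
  renaming (trans to ≡-trans)
import Relation.Binary.Reasoning.PartialOrder as PosetReasoning

module EnrichedFacts {o h ℓ} (K : ωCpoJoinCat o h ℓ) where
  open ωCpoJoinCat K

  ≤-reflexive : ∀ {A B} {f g : Hom A B} → f ≡ g → f ≤ g
  ≤-reflexive {f = f} e = subst (f ≤_) e ≤-refl

  homPoset : Obj → Obj → Poset h h ℓ
  homPoset A B = record
    { Carrier = Hom A B
    ; _≈_ = _≡_
    ; _≤_ = _≤_
    ; isPartialOrder = record
        { isPreorder = record
            { isEquivalence = isEquivalence
            ; reflexive = ≤-reflexive
            ; trans = ≤-trans }
        ; antisym = ≤-antisym }
    }

  module HomReasoning {A B : Obj} = PosetReasoning (homPoset A B)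

  ∘-monoˡ : ∀ {A B C} {f : Hom A B} {g g' : Hom B C} → g ≤ g' → g ∘ f ≤ g' ∘ f
  ∘-monoˡ p = ∘-mono ≤-refl p

  ∘-monoʳ : ∀ {A B C} {f f' : Hom A B} {g : Hom B C} → f ≤ f' → g ∘ f ≤ g ∘ f'
  ∘-monoʳ p = ∘-mono p ≤-refl

  id-com : ∀ {A B} (g : Hom A B) → g ∘ id ≤ id ∘ g
  id-com g = ≤-reflexive (≡-trans (identityʳ g) (sym (identityˡ g)))

  ∘-com : ∀ {A B} {g : Hom A B} {x₁ x₂ : Hom A A} {y₁ y₂ : Hom B B} →
          g ∘ x₁ ≤ y₁ ∘ g → g ∘ x₂ ≤ y₂ ∘ g → g ∘ (x₁ ∘ x₂) ≤ (y₁ ∘ y₂) ∘ g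
  ∘-com {g = g} {x₁} {x₂} {y₁} {y₂} p₁ p₂ = begin
    g ∘ (x₁ ∘ x₂)    ≡⟨ assoc x₂ x₁ g ⟨
    (g ∘ x₁) ∘ x₂    ≤⟨ ∘-monoˡ p₁ ⟩
    (y₁ ∘ g) ∘ x₂    ≡⟨ assoc x₂ g y₁ ⟩
    y₁ ∘ (g ∘ x₂)    ≤⟨ ∘-monoʳ p₂ ⟩
    y₁ ∘ (y₂ ∘ g)    ≡⟨ assoc g y₂ y₁ ⟨
    (y₁ ∘ y₂) ∘ g    ∎
    where open HomReasoning

  pow : ∀ {A} → Hom A A → ℕ → Hom A A
  pow x zero    = id
  pow x (suc i) = x ∘ pow x i

  pow-+ : ∀ {A} (x : Hom A A) a b → pow x a ∘ pow x b ≡ pow x (a + b)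
  pow-+ x zero    b = identityˡ (pow x b)
  pow-+ x (suc a) b = begin
    (x ∘ pow x a) ∘ pow x b   ≡⟨ assoc (pow x b) (pow x a) x ⟩
    x ∘ (pow x a ∘ pow x b)   ≡⟨ cong (x ∘_) (pow-+ x a b) ⟩
    x ∘ pow x (a + b)         ∎
    where open ≡-Reasoning

  pow-mono : ∀ {A} {x y : Hom A A} → x ≤ y → ∀ i → pow x i ≤ pow y i
  pow-mono p zero    = ≤-refl
  pow-mono p (suc i) = ∘-mono (pow-mono p i) p

  pow-com : ∀ {A B} {g : Hom A B} {x : Hom A A} {y : Hom B B} →
            g ∘ x ≤ y ∘ g → ∀ i → g ∘ pow x i ≤ pow y i ∘ g
  pow-com {g = g} p zero    = id-com g
  pow-com         p (suc i) = ∘-com p (pow-com p i)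

  pow-step : ∀ {A} {x : Hom A A} → id ≤ x → ∀ i → pow x i ≤ pow x (suc i)
  pow-step {x = x} u i = begin
    pow x i         ≡⟨ identityˡ (pow x i) ⟨
    id ∘ pow x i    ≤⟨ ∘-monoˡ u ⟩
    x ∘ pow x i     ∎
    where open HomReasoning

  ≤-pow : ∀ {A} {x : Hom A A} → id ≤ x → ∀ i → x ≤ pow x (suc i)
  ≤-pow {x = x} u zero    = ≤-reflexive (sym (identityʳ x))
  ≤-pow         u (suc i) = ≤-trans (≤-pow u i) (∘-monoʳ (pow-step u i))

  closure-pow : ∀ {A} {r : Hom A A} → id ≤ r → r ∘ r ≤ r → ∀ i → pow r i ≤ r
  closure-pow u m zero    = u
  closure-pow u m (suc i) = ≤-trans (∘-monoʳ (closure-pow u m i)) m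

  chain-mono : ∀ {A B} {c : ℕ → Hom A B} → (∀ n → c n ≤ c (suc n)) →
               ∀ {m n} → m ≤ℕ n → c m ≤ c n
  chain-mono {c = c} asc m≤n = go (≤⇒≤′ m≤n)
    where
    go : ∀ {m n} → m ≤′ n → c m ≤ c n
    go ≤′-refl        = ≤-refl
    go (≤′-step m≤′n) = ≤-trans (go m≤′n) (asc _)

  ∘-sup-least : ∀ {A B C} (g : Hom B C) (c : ℕ → Hom A B) asc {z : Hom A C} →
                (∀ k → g ∘ c k ≤ z) → g ∘ sup c asc ≤ z
  ∘-sup-least g c asc bound =
    ≤-trans (≤-reflexive (∘-supʳ g c asc)) (sup-least _ _ bound)

  sup-∘-least : ∀ {A B C} (c : ℕ → Hom B C) asc (f : Hom A B) {z : Hom A C} →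
                (∀ k → c k ∘ f ≤ z) → sup c asc ∘ f ≤ z
  sup-∘-least c asc f bound =
    ≤-trans (≤-reflexive (∘-supˡ c asc f)) (sup-least _ _ bound)

  sup-∘-sup-least : ∀ {A B C} (a : ℕ → Hom B C) asca (b : ℕ → Hom A B) ascb
                    {z : Hom A C} → (∀ k m → a k ∘ b m ≤ z) →
                    sup a asca ∘ sup b ascb ≤ z
  sup-∘-sup-least a asca b ascb bound =
    sup-∘-least a asca _ λ k → ∘-sup-least (a k) b ascb (bound k)

  ∨-com : LeftDistributive K → ∀ {A B} {g : Hom A B} {a b : Hom A A} {y : Hom B B} →
          g ∘ a ≤ y ∘ g → g ∘ b ≤ y ∘ g → g ∘ (a ∨ b) ≤ y ∘ g
  ∨-com LD {g = g} {a} {b} pa pb =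
    ≤-trans (≤-reflexive (LD g a b)) (∨-least pa pb)

module FreeClosure {o h ℓ j} {K : ωCpoJoinCat o h ℓ} {J : WideSubcategory K j}
                   (P : LaxSeq K J) where
  open ωCpoJoinCat K
  open EnrichedFacts K
  open LaxSeq P

  c : ℕ → Hom carrier carrier
  c zero    = π 0
  c (suc k) = c k ∨ π (suc k)

  c-asc : ∀ k → c k ≤ c (suc k)
  c-asc k = ∨-inl (c k) (π (suc k))

  π≤c : ∀ n → π n ≤ c n
  π≤c zero    = ≤-refl
  π≤c (suc n) = ∨-inr (c n) (π (suc n))

  id≤c : ∀ k → id ≤ c k
  id≤c k = ≤-trans unit (chain-mono c-asc (z≤n {k}))

  -- dₖ = cₖ^(k+1); raising the exponent along with k makes the chain
  -- absorb the composites dₖ ∘ dₘ.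
  d : ℕ → Hom carrier carrier
  d k = pow (c k) (suc k)

  d-asc : ∀ k → d k ≤ d (suc k)
  d-asc k = ≤-trans (pow-mono (c-asc k) (suc k)) (pow-step (id≤c (suc k)) (suc k))

  d-mult : ∀ k m → d k ∘ d m ≤ d (k + suc m)
  d-mult k m = begin
    d k ∘ d m                                  ≤⟨ ∘-mono (pow-mono cm≤cN (suc m))
                                                          (pow-mono ck≤cN (suc k)) ⟩
    pow (c N) (suc k) ∘ pow (c N) (suc m)      ≡⟨ pow-+ (c N) (suc k) (suc m) ⟩
    d N                                        ∎
    where
    open HomReasoning
    N = k + suc m
    ck≤cN : c k ≤ c N
    ck≤cN = chain-mono c-asc (m≤m+n k (suc m))
    cm≤cN : c m ≤ c N
    cm≤cN = chain-mono c-asc (ℕ≤-trans (n≤1+n m) (m≤n+m (suc m) k))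

  ρ : Hom carrier carrier
  ρ = sup d d-asc

  π≤ρ : ∀ n → π n ≤ ρ
  π≤ρ n = ≤-trans (π≤c n) (≤-trans (≤-pow (id≤c n) n) (sup-upper d d-asc n))

  ρ-unit : id ≤ ρ
  ρ-unit = ≤-trans unit (π≤ρ 0)

  ρ-mult : ρ ∘ ρ ≤ ρ
  ρ-mult = sup-∘-sup-least d d-asc d d-asc λ k m →
             ≤-trans (d-mult k m) (sup-upper d d-asc (k + suc m))

  closure : LaxMonad K J
  closure = record { carrier = carrier ; ρ = ρ ; unit = ρ-unit ; mult = ρ-mult }

  ρ-least : LeftDistributive K → ∀ {B} {g : Hom carrier B} {y : Hom B B} →
            id ≤ y → y ∘ y ≤ y → (∀ n → g ∘ π n ≤ y ∘ g) → g ∘ ρ ≤ y ∘ g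
  ρ-least LD {g = g} {y} y-unit y-mult g-com = ∘-sup-least g d d-asc λ k → begin
    g ∘ d k                ≤⟨ pow-com (c-com k) (suc k) ⟩
    pow y (suc k) ∘ g      ≤⟨ ∘-monoˡ (closure-pow y-unit y-mult (suc k)) ⟩
    y ∘ g                  ∎
    where
    open HomReasoning
    c-com : ∀ k → g ∘ c k ≤ y ∘ g
    c-com zero    = g-com 0
    c-com (suc k) = ∨-com LD (c-com k) (g-com (suc k))

-- Both functors and the hom-bijection
-- are the identity on underlying arrows; only the lax-commutation
-- witnesses change, so every equational law holds by reflexivity.
module LeftAdjoint {o h ℓ j} (K : ωCpoJoinCat o h ℓ) (LD : LeftDistributive K)
                   (J : WideSubcategory K j) where
  open ωCpoJoinCat K
  open EnrichedFacts K
  open LaxSeqHom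
  open LaxMonadHom
  module Cl = FreeClosure {J = J}

  -- A morphism of lax sequences carries each πₙ into ρ_Q, hence ρ_P into ρ_Q.
  Σ!-hom : ∀ {P Q} → LaxSeqHom K J P Q →
           LaxMonadHom K J (Cl.closure P) (Cl.closure Q)
  Σ!-hom {P} {Q} f = record
    { arr = arr f
    ; inJ = inJ f
    ; com = Cl.ρ-least P LD (Cl.ρ-unit Q) (Cl.ρ-mult Q)
              (λ n → ≤-trans (com f n) (∘-monoˡ (Cl.π≤ρ Q n)))
    }

  Σ! : OrdFunctor (LaxSeqCat K J) (LaxMonadCat K J)
  Σ! = record
    { F₀ = Cl.closure
    ; F₁ = Σ!-hom
    ; F-resp-≈ = λ e → e
    ; F-id = refl
    ; F-∘ = λ _ _ → refl
    ; F-mono = λ p → p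
    }

  -- Restriction along πₙ ≤ ρ: a morphism Σ! P → Y is a morphism P → (ρ_Y)ₙ.
  restrict : ∀ {P Y} → LaxMonadHom K J (Cl.closure P) Y →
             LaxSeqHom K J P (constSeq K J Y)
  restrict {P} f = record
    { arr = arr f
    ; inJ = inJ f
    ; com = λ n → ≤-trans (∘-monoʳ (Cl.π≤ρ P n)) (com f)
    }

  extend : ∀ {P Y} → LaxSeqHom K J P (constSeq K J Y) →
           LaxMonadHom K J (Cl.closure P) Y
  extend {P} {Y} g = record
    { arr = arr g
    ; inJ = inJ g
    ; com = Cl.ρ-least P LD (LaxMonad.unit Y) (LaxMonad.mult Y) (com g)
    }

  adjunction : Left2Adjoint Σ! (BangFunctor K J)
  adjunction = record
    { φ = restrict
    ; ψ = extend
    ; φ-resp-≈ = λ e → e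
    ; ψ-resp-≈ = λ e → e
    ; ψφ = λ _ → refl
    ; φψ = λ _ → refl
    ; φ-mono = λ p → p
    ; ψ-mono = λ p → p
    ; natural = λ _ _ _ → refl
    }

theorem3p18 : ∀ {o h ℓ j} (K : ωCpoJoinCat o h ℓ) → LeftDistributive K →
    (J : WideSubcategory K j) →
    Σ (OrdFunctor (LaxSeqCat K J) (LaxMonadCat K J))
    (λ Σ! → Left2Adjoint Σ! (BangFunctor K J))
theorem3p18 K LD J = Σ! , adjunction
  where open LeftAdjoint K LD J
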